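{- For all positive integers $s>1$ and $t$, \[ A(s-1,t)\le tC(s,t)<A(s,t+1). \]
   Context: Ackermann function: $A(1,t)=2t$, $A(s,1)=2$, $A(s,t)=A(s-1,A(s,t-1))$ for $s,t>1$. The function $C$: $C(1,t)=1$ for all $t$; $C(s,1)=2$ for $s>1$; $C(s,t)=C(s,t-1)\,C(s-1,C(s,t-1))$ for $s,t>1$. -}

module Defs where

open import Data.Nat using (ℕ; zero; suc; _*_)

-- Ackermann function A(s,t), meaningful for s,t ≥ 1:
--   A(1,t) = 2t,  A(s,1) = 2,  A(s,t) = A(s-1, A(s,t-1)) for s,t > 1.
-- Values with s = 0 or t = 0 are junk (set to 0) and never used.
A : ℕ → ℕ → ℕ
A zero t = 0
A (suc zero) t = 2 * t
A (suc (suc s)) zero = 0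
A (suc (suc s)) (suc zero) = 2
A (suc (suc s)) (suc (suc t)) = A (suc s) (A (suc (suc s)) (suc t))

-- C(1,t) = 1,  C(s,1) = 2 for s > 1,
-- C(s,t) = C(s,t-1) * C(s-1, C(s,t-1)) for s,t > 1.
-- Values with s = 0 or (s > 1 and t = 0) are junk (0) and never used.
C : ℕ → ℕ → ℕ
C zero t = 0
C (suc zero) t = 1
C (suc (suc s)) zero = 0
C (suc (suc s)) (suc zero) = 2
C (suc (suc s)) (suc (suc t)) =
  C (suc (suc s)) (suc t) * C (suc s) (C (suc (suc s)) (suc t))

{-# OPTIONS --safe #-}
module Submission where

-- For s = 2 everything is explicit: A(1,t) = 2t, C(2,t) = 2 and A(2,t+1) = 2^(t+1).
-- For s ≥ 3 the lower bound comes from the sharper A(s-1,t) ≤ C(s,t), whose inductive step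
--   A(s-2, A(s-1,t)) ≤ A(s-2, C(s,t)) ≤ C(s,t) · C(s-1, C(s,t)) = C(s,t+1)
-- is the lower bound one level down.  For the upper bound, A(s,·) at least doubles at every
-- step, so (k+1) · A(s-1,m) ≤ 2^k · A(s-1,m) ≤ A(s-1,m+k).  With c = C(s,t) this gives
--   (t+1) · C(s,t+1) = (t+1) · c · C(s-1,c) < (t+1) · A(s-1,c+1) ≤ A(s-1,c+t+1) ≤ A(s,t+2),
-- using the upper bound at (s-1,c), and at (s,t) in the form c + t ≤ t · c < A(s,t+1)
-- (valid for t ≥ 2 since c ≥ 2).

open import Defs
open import Data.Nat using (ℕ; _≤_; _<_; _*_; _∸_; _+_; _^_; zero; suc; z≤n; s≤s; _≤′_; ≤′-refl; ≤′-step)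
open import Data.Nat.Properties
open import Data.Product using (_×_; _,_)
open import Relation.Binary.PropositionalEquality

2+n≤2*[1+n] : ∀ n → 2 + n ≤ 2 * suc n
2+n≤2*[1+n] n = ≤-trans (+-monoʳ-≤ 2 (m≤n*m n 2)) (≤-reflexive (sym (*-distribˡ-+ 2 1 n)))

n<2^n : ∀ n → n < 2 ^ n
n<2^n zero = s≤s z≤n
n<2^n (suc n) = ≤-trans (2+n≤2*[1+n] n) (*-monoʳ-≤ 2 (n<2^n n))

m+n≤m*n : ∀ {m n} → 2 ≤ m → 2 ≤ n → m + n ≤ m * n
m+n≤m*n {suc m@(suc k)} {n} (s≤s (s≤s z≤n)) 2≤n = begin
  suc m + n  ≡⟨ +-comm (suc m) n ⟩
  n + suc m  ≤⟨ +-monoʳ-≤ n (2+n≤2*[1+n] k) ⟩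
  n + 2 * m  ≡⟨ cong (n +_) (*-comm 2 m) ⟩
  n + m * 2  ≤⟨ +-monoʳ-≤ n (*-monoʳ-≤ m 2≤n) ⟩
  n + m * n  ∎
  where open ≤-Reasoning

2*n≤A : ∀ s n → 2 * n ≤ A (suc s) n
2*n≤A zero n = ≤-refl
2*n≤A (suc s) zero = z≤n
2*n≤A (suc s) (suc zero) = ≤-refl
2*n≤A (suc s) (suc (suc n)) =
  ≤-trans (*-monoʳ-≤ 2 (≤-trans (2+n≤2*[1+n] n) (2*n≤A (suc s) (suc n))))
          (2*n≤A s (A (2 + s) (suc n)))

2*A≤A-suc : ∀ s n → 2 * A (2 + s) n ≤ A (2 + s) (suc n)
2*A≤A-suc s zero = z≤n
2*A≤A-suc s (suc n) = 2*n≤A s (A (2 + s) (suc n))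

A≤A-suc : ∀ s n → A (suc s) n ≤ A (suc s) (suc n)
A≤A-suc zero n = *-monoʳ-≤ 2 (n≤1+n n)
A≤A-suc (suc s) n = ≤-trans (m≤n*m (A (2 + s) n) 2) (2*A≤A-suc s n)

A-monoʳ-≤ : ∀ s {m n} → m ≤ n → A (suc s) m ≤ A (suc s) n
A-monoʳ-≤ s m≤n = mono (≤⇒≤′ m≤n)
  where
  mono : ∀ {m n} → m ≤′ n → A (suc s) m ≤ A (suc s) n
  mono ≤′-refl = ≤-refl
  mono (≤′-step m≤′n) = ≤-trans (mono m≤′n) (A≤A-suc s _)

2^k*A≤A[k+n] : ∀ s k n → 2 ^ k * A (2 + s) n ≤ A (2 + s) (k + n)
2^k*A≤A[k+n] s zero n = ≤-reflexive (*-identityˡ (A (2 + s) n))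
2^k*A≤A[k+n] s (suc k) n = begin
  2 * 2 ^ k * A (2 + s) n    ≡⟨ *-assoc 2 (2 ^ k) (A (2 + s) n) ⟩
  2 * (2 ^ k * A (2 + s) n)  ≤⟨ *-monoʳ-≤ 2 (2^k*A≤A[k+n] s k n) ⟩
  2 * A (2 + s) (k + n)      ≤⟨ 2*A≤A-suc s (k + n) ⟩
  A (2 + s) (suc k + n)      ∎
  where open ≤-Reasoning

A-2≡2^ : ∀ n → A 2 (suc n) ≡ 2 ^ suc n
A-2≡2^ zero = refl
A-2≡2^ (suc n) = cong (2 *_) (A-2≡2^ n)

C-2≡2 : ∀ n → C 2 (suc n) ≡ 2
C-2≡2 zero = refl
C-2≡2 (suc n) = trans (*-identityʳ (C 2 (suc n))) (C-2≡2 n)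

mutual
  1≤C : ∀ s n → 1 ≤ n → 1 ≤ C (suc s) n
  1≤C zero n _ = ≤-refl
  1≤C (suc s) n 1≤n = ≤-trans (n≤1+n 1) (2≤C s n 1≤n)

  2≤C : ∀ s n → 1 ≤ n → 2 ≤ C (2 + s) n
  2≤C s (suc zero) _ = ≤-refl
  2≤C s (suc (suc n)) _ =
    let 2≤c = 2≤C s (suc n) (s≤s z≤n) in *-mono-≤ 2≤c (1≤C s _ (≤-trans (n≤1+n 1) 2≤c))

mutual
  A≤n*C : ∀ s n → A (suc s) n ≤ n * C (2 + s) n
  A≤n*C zero zero = z≤n
  A≤n*C zero (suc n) = ≤-reflexive (trans (*-comm 2 (suc n)) (cong (suc n *_) (sym (C-2≡2 n))))
  A≤n*C (suc s) zero = z≤n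
  A≤n*C (suc s) (suc n) = ≤-trans (A≤C s (suc n)) (m≤n*m _ (suc n))

  A≤C : ∀ s n → A (2 + s) n ≤ C (3 + s) n
  A≤C s zero = z≤n
  A≤C s (suc zero) = ≤-refl
  A≤C s (suc (suc n)) = ≤-trans (A-monoʳ-≤ s (A≤C s (suc n))) (A≤n*C s (C (3 + s) (suc n)))

mutual
  n*C<A : ∀ s n → n * C (2 + s) n < A (2 + s) (suc n)
  n*C<A zero zero = s≤s z≤n
  n*C<A zero (suc n) = begin-strict
    suc n * C 2 (suc n)  ≡⟨ cong (suc n *_) (C-2≡2 n) ⟩
    suc n * 2            ≡⟨ *-comm (suc n) 2 ⟩
    2 * suc n            <⟨ *-monoʳ-< 2 (n<2^n (suc n)) ⟩
    2 ^ suc (suc n)      ≡⟨ sym (A-2≡2^ (suc n)) ⟩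
    A 2 (suc (suc n))    ∎
    where open ≤-Reasoning
  n*C<A (suc s) zero = s≤s z≤n
  n*C<A (suc s) (suc zero) = ≤-trans (n≤1+n 3) (2*n≤A (suc (suc s)) 2)
  n*C<A (suc s) (suc (suc n)) = begin-strict
    suc (suc n) * (c * C (2 + s) c)  <⟨ *-monoʳ-< (suc (suc n)) (n*C<A s c) ⟩
    suc (suc n) * A (2 + s) (suc c)  ≤⟨ *-monoˡ-≤ (A (2 + s) (suc c)) (n<2^n (suc n)) ⟩
    2 ^ suc n * A (2 + s) (suc c)    ≤⟨ 2^k*A≤A[k+n] s (suc n) (suc c) ⟩
    A (2 + s) (suc n + suc c)        ≡⟨ cong (A (2 + s)) (+-suc (suc n) c) ⟩
    A (2 + s) (suc (suc n + c))      ≤⟨ A-monoʳ-≤ (suc s) (n+C<A (suc s) (suc n)) ⟩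
    A (2 + s) (A (3 + s) (suc (suc n)))  ∎
    where
    open ≤-Reasoning
    c = C (3 + s) (suc n)

  n+C<A : ∀ s n → n + C (2 + s) n < A (2 + s) (suc n)
  n+C<A s zero = s≤s z≤n
  n+C<A s (suc zero) = 2*n≤A (suc s) 2
  n+C<A s (suc (suc n)) =
    ≤-<-trans (m+n≤m*n (s≤s (s≤s z≤n)) (2≤C s (suc (suc n)) (s≤s z≤n))) (n*C<A s (suc (suc n)))

mainTheorem6 : (s t : ℕ) → 1 < s → 1 ≤ t →
    (A (s ∸ 1) t ≤ t * C s t) × (t * C s t < A s (t + 1))
mainTheorem6 (suc (suc s)) t (s≤s (s≤s z≤n)) _ =
  A≤n*C s t , subst (λ t+1 → t * C (2 + s) t < A (2 + s) t+1) (+-comm 1 t) (n*C<A s t)
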